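{- For every mt-logic formula $\varphi$ over $\tau$, every $\tau$-structure $\mathcal M$ and team $X$ with $\mathrm{FV}(\exists x\varphi)\subseteq\mathrm{dom}(X)$ (resp. $\mathrm{FV}(\forall x\varphi)\subseteq\mathrm{dom}(X)$): (a) $\mathcal M,X\models\exists x\varphi$ iff there is a function $F:\exists xX\to\mathcal P(M)\setminus\{\emptyset\}$ such that $\mathcal M,(\exists xX)[F/x]\models\varphi$; (b) $\mathcal M,X\models\forall x\varphi$ iff there is a function $F:(\exists xX)^c\to\mathcal P(M)\setminus\{M\}$ such that $\mathcal M,(\exists xX)[M/x]\cup(\exists xX)^c[F/x]\models\varphi$, where $(\exists xX)^c$ is the set of all assignments $s:\mathrm{dom}(X)\setminus\{x\}\to M$ not in $\exists xX$.
   Context: $\mathcal M$ has universe $M$. Assignments are functions $s:V\to M$ ($V$ finite set of variables); $s[a/x]$ modifies/extends $s$ to send $x$ to $a$. A team $X$ is a finite set $\mathrm{dom}(X)$ of variables with a set (also denoted $X$) of assignments with domain $\mathrm{dom}(X)$ (one empty team per domain). $\exists xX=\{s:\mathrm{dom}(X)\setminus\{x\}\to M\mid s[a/x]\in X\text{ for some }a,\text{ or }s\in X\}$, $\forall xX=\{s:\mathrm{dom}(X)\setminus\{x\}\to M\mid s[a/x]\in X\text{ for all }a\in M,\text{ or }s\in X\}$, both with domain $\mathrm{dom}(X)\setminus\{x\}$. For a team $X$ and $F:X\to\mathcal P(M)$, $X[F/x]=\{s[a/x]\mid s\in X,a\in F(s)\}$; $X[M/x]=\{s[a/x]\mid s\in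 X,a\in M\}$ (domain $\mathrm{dom}(X)\cup\{x\}$). mt-logic formulas: literals (atomic formulas and negations), $\varphi\wedge^{\mathrm{in}}\psi$, $\varphi\vee^{\mathrm{in}}\psi$ (internal), $\varphi\wedge\psi$, $\varphi\vee\psi$ (external), $\exists x\varphi$, $\forall x\varphi$. Satisfaction for $\mathrm{FV}(\varphi)\subseteq\mathrm{dom}(X)$: literal $\psi$: for every $s:\mathrm{dom}(X)\to M$, $s\in X$ iff $\mathcal M,s\models\psi$; $\varphi\wedge^{\mathrm{in}}\psi$: $X=Y\cap Z$ for some $Y\models\varphi$, $Z\models\psi$; $\varphi\vee^{\mathrm{in}}\psi$: $X=Y\cup Z$ for some $Y\models\varphi$, $Z\models\psi$; $\varphi\wedge\psi$: $X\models\varphi$ and $X\models\psi$; $\varphi\vee\psi$: $X\models\varphi$ or $X\models\psi$; $\exists x\varphi$: some $Y$ with $x\in\mathrm{dom}(Y)$, $\exists xY=\exists xX$, $Y\models\varphi$; $\forall x\varphi$: some $Y$ with $x\in\mathrm{dom}(Y)$, $\forall xY=\exists xX$, $Y\models\varphi$. -}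

module Defs where

open import Data.Nat using (ℕ; _≟_)
open import Data.Nat.Properties using ()
open import Data.List using (List; _∷_; []; filter; _++_; concatMap)
open import Data.List.Membership.Propositional using (_∈_)
open import Data.List.Membership.Propositional.Properties using (∈-filter⁺)
open import Data.List.Relation.Unary.Any using (here; there)
open import Data.Vec using (Vec; []; _∷_)
open import Data.Product using (Σ; _×_; _,_; proj₁; proj₂; Σ-syntax)
open import Data.Sum using (_⊎_; inj₁; inj₂)
open import Data.Empty using (⊥; ⊥-elim)
open import Relation.Nullary using (¬_; yes; no; ¬?)
open import Relation.Binary.PropositionalEquality using (_≡_; refl; sym; trans; subst)
open import Function.Bundles using (_⇔_)
open import Level using (Lift; lift; suc; 0ℓ)

Var : Set
Var = ℕ

record Signature : Set₁ where
  field
    Rel   : Set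
    relAr : Rel → ℕ
    Fun   : Set
    funAr : Fun → ℕ
open Signature public

data Term (τ : Signature) : Set where
  var : Var → Term τ
  app : (f : Fun τ) → Vec (Term τ) (funAr τ f) → Term τ

record Structure (τ : Signature) : Set₁ where
  field
    Carrier : Set
    relI    : (R : Rel τ) → Vec Carrier (relAr τ R) → Set
    funI    : (f : Fun τ) → Vec Carrier (funAr τ f) → Carrier
open Structure public

-- variables are natural numbers; an assignment with domain V is represented
-- by a total function ℕ → M, of which only the values on V matter
Asg : Set → Set
Asg M = Var → M

_[_/_] : {M : Set} → Asg M → M → Var → Asg M
(s [ a / x ]) v with v ≟ x
... | yes _ = a
... | no  _ = s v

-- agreement on a finite set of variables (= equality as assignments with domain D)
Agree : {M : Set} → List Var → Asg M → Asg M → Set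
Agree D s t = ∀ v → v ∈ D → s v ≡ t v

remove : Var → List Var → List Var
remove x D = filter (λ v → ¬? (v ≟ x)) D

mutual
  evalT : {τ : Signature} (𝓜 : Structure τ) → Asg (Carrier 𝓜) → Term τ → Carrier 𝓜
  evalT 𝓜 s (var v)    = s v
  evalT 𝓜 s (app f ts) = funI 𝓜 f (evalTs 𝓜 s ts)

  evalTs : {τ : Signature} (𝓜 : Structure τ) {n : ℕ} → Asg (Carrier 𝓜) → Vec (Term τ) n → Vec (Carrier 𝓜) n
  evalTs 𝓜 s []       = []
  evalTs 𝓜 s (t ∷ ts) = evalT 𝓜 s t ∷ evalTs 𝓜 s ts

mutual
  fvT : {τ : Signature} → Term τ → List Var
  fvT (var v)    = v ∷ []
  fvT (app f ts) = fvTs ts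

  fvTs : {τ : Signature} {n : ℕ} → Vec (Term τ) n → List Var
  fvTs []       = []
  fvTs (t ∷ ts) = fvT t ++ fvTs ts

data Atom (τ : Signature) : Set where
  _≐_  : Term τ → Term τ → Atom τ
  rel  : (R : Rel τ) → Vec (Term τ) (relAr τ R) → Atom τ

data Literal (τ : Signature) : Set where
  pos : Atom τ → Literal τ
  neg : Atom τ → Literal τ

data Formula (τ : Signature) : Set where
  lit  : Literal τ → Formula τ
  _∧ⁱ_ : Formula τ → Formula τ → Formula τ
  _∨ⁱ_ : Formula τ → Formula τ → Formula τ
  _∧ᵉ_ : Formula τ → Formula τ → Formula τ
  _∨ᵉ_ : Formula τ → Formula τ → Formula τ
  ex   : Var → Formula τ → Formula τ
  all  : Var → Formula τ → Formula τ

fvA : {τ : Signature} → Atom τ → List Var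
fvA (t ≐ u)    = fvT t ++ fvT u
fvA (rel R ts) = fvTs ts

fvL : {τ : Signature} → Literal τ → List Var
fvL (pos a) = fvA a
fvL (neg a) = fvA a

fv : {τ : Signature} → Formula τ → List Var
fv (lit l)   = fvL l
fv (φ ∧ⁱ ψ)  = fv φ ++ fv ψ
fv (φ ∨ⁱ ψ)  = fv φ ++ fv ψ
fv (φ ∧ᵉ ψ)  = fv φ ++ fv ψ
fv (φ ∨ᵉ ψ)  = fv φ ++ fv ψ
fv (ex x φ)  = remove x (fv φ)
fv (all x φ) = remove x (fv φ)

SatA : {τ : Signature} (𝓜 : Structure τ) → Asg (Carrier 𝓜) → Atom τ → Set
SatA 𝓜 s (t ≐ u)    = evalT 𝓜 s t ≡ evalT 𝓜 s u
SatA 𝓜 s (rel R ts) = relI 𝓜 R (evalTs 𝓜 s ts)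

SatL : {τ : Signature} (𝓜 : Structure τ) → Asg (Carrier 𝓜) → Literal τ → Set
SatL 𝓜 s (pos a) = SatA 𝓜 s a
SatL 𝓜 s (neg a) = ¬ SatA 𝓜 s a

-- Teams: a finite domain of variables and a set of assignments with that
-- domain (a predicate on total assignments, invariant under agreement on dom)

record Team (M : Set) : Set₁ where
  field
    dom  : List Var
    mem  : Asg M → Set
    resp : ∀ {s t} → Agree dom s t → mem s → mem t
open Team public

SameDom : List Var → List Var → Set
SameDom D E = ∀ v → (v ∈ D → v ∈ E) × (v ∈ E → v ∈ D)

_≗T_ : {M : Set} → Team M → Team M → Set
X ≗T Y = SameDom (dom X) (dom Y) × (∀ s → (mem X s → mem Y s) × (mem Y s → mem X s))

private
  agree-sym : {M : Set} {D : List Var} {s t : Asg M} → Agree D s t → Agree D t s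
  agree-sym p v v∈ = sym (p v v∈)

  agree-trans : {M : Set} {D : List Var} {s t u : Asg M} → Agree D s t → Agree D t u → Agree D s u
  agree-trans p q v v∈ = trans (p v v∈) (q v v∈)

  upd-agree : {M : Set} (x : Var) (D : List Var) (a : M) {s t : Asg M} →
              Agree (remove x D) s t → Agree D (s [ a / x ]) (t [ a / x ])
  upd-agree x D a p v v∈ with v ≟ x
  ... | yes _  = refl
  ... | no v≢x = p v (∈-filter⁺ (λ w → ¬? (w ≟ x)) v∈ v≢x)

  upd-agree' : {M : Set} (x : Var) (D : List Var) (a : M) {s t : Asg M} →
               Agree D s t → Agree (x ∷ D) (s [ a / x ]) (t [ a / x ])
  upd-agree' x D a p v (here refl) with v ≟ v
  ... | yes _ = refl
  ... | no v≢v = ⊥-elim (v≢v refl)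
  upd-agree' x D a p v (there v∈) with v ≟ x
  ... | yes _ = refl
  ... | no _  = p v v∈

∃ˣ : {M : Set} → Var → Team M → Team M
∃ˣ {M} x X = record
  { dom  = remove x (dom X)
  ; mem  = λ s → Σ[ a ∈ M ] mem X (s [ a / x ])
  ; resp = λ {s} {t} p (a , m) → a , resp X (upd-agree x (dom X) a p) m }

∀ˣ : {M : Set} → Var → Team M → Team M
∀ˣ {M} x X = record
  { dom  = remove x (dom X)
  ; mem  = λ s → (a : M) → mem X (s [ a / x ])
  ; resp = λ {s} {t} p m a → resp X (upd-agree x (dom X) a p) (m a) }

_ᶜ : {M : Set} → Team M → Team M
X ᶜ = record
  { dom  = dom X
  ; mem  = λ s → ¬ mem X s
  ; resp = λ p ns m → ns (resp X (agree-sym p) m) }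

_[_/_]ᵀ : {M : Set} → (X : Team M) → (Asg M → M → Set) → Var → Team M
_[_/_]ᵀ {M} X F x = record
  { dom  = x ∷ dom X
  ; mem  = λ t → Σ[ s ∈ Asg M ] mem X s × Σ[ a ∈ M ] F s a × Agree (x ∷ dom X) t (s [ a / x ])
  ; resp = λ p (s , m , a , f , q) → s , m , a , f , agree-trans (agree-sym p) q }

_[M/_] : {M : Set} → (X : Team M) → Var → Team M
_[M/_] {M} X x = record
  { dom  = x ∷ dom X
  ; mem  = λ t → Σ[ s ∈ Asg M ] mem X s × Σ[ a ∈ M ] Agree (x ∷ dom X) t (s [ a / x ])
  ; resp = λ p (s , m , a , q) → s , m , a , agree-trans (agree-sym p) q }

∪ᵀ : {M : Set} → (X Y : Team M) → dom Y ≡ dom X → Team M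
∪ᵀ X Y e = record
  { dom  = dom X
  ; mem  = λ s → mem X s ⊎ mem Y s
  ; resp = λ { p (inj₁ m) → inj₁ (resp X p m)
             ; p (inj₂ m) → inj₂ (resp Y (subst (λ D → Agree D _ _) (sym e) p) m) } }

-- F : X → 𝒫(M) is a function on the assignments of X (represented on total
-- assignments, required to depend only on their restriction to dom(X))
WellDefinedOn : {M : Set} → Team M → (Asg M → M → Set) → Set
WellDefinedOn X F = ∀ {s t} → Agree (dom X) s t → ∀ a → F s a → F t a

_,_⊨_ : {τ : Signature} (𝓜 : Structure τ) → Team (Carrier 𝓜) → Formula τ → Set₁
𝓜 , X ⊨ lit l   = Lift (suc 0ℓ) (∀ s → (mem X s → SatL 𝓜 s l) × (SatL 𝓜 s l → mem X s))
𝓜 , X ⊨ (φ ∧ⁱ ψ) = Σ[ Y ∈ Team (Carrier 𝓜) ] Σ[ Z ∈ Team (Carrier 𝓜) ]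
    SameDom (dom X) (dom Y) × SameDom (dom X) (dom Z) ×
    (∀ s → (mem X s → mem Y s × mem Z s) × (mem Y s × mem Z s → mem X s)) ×
    (𝓜 , Y ⊨ φ) × (𝓜 , Z ⊨ ψ)
𝓜 , X ⊨ (φ ∨ⁱ ψ) = Σ[ Y ∈ Team (Carrier 𝓜) ] Σ[ Z ∈ Team (Carrier 𝓜) ]
    SameDom (dom X) (dom Y) × SameDom (dom X) (dom Z) ×
    (∀ s → (mem X s → mem Y s ⊎ mem Z s) × (mem Y s ⊎ mem Z s → mem X s)) ×
    (𝓜 , Y ⊨ φ) × (𝓜 , Z ⊨ ψ)
𝓜 , X ⊨ (φ ∧ᵉ ψ) = (𝓜 , X ⊨ φ) × (𝓜 , X ⊨ ψ)
𝓜 , X ⊨ (φ ∨ᵉ ψ) = (𝓜 , X ⊨ φ) ⊎ (𝓜 , X ⊨ ψ)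
𝓜 , X ⊨ ex x φ  = Σ[ Y ∈ Team (Carrier 𝓜) ] x ∈ dom Y × (∃ˣ x Y ≗T ∃ˣ x X) × (𝓜 , Y ⊨ φ)
𝓜 , X ⊨ all x φ = Σ[ Y ∈ Team (Carrier 𝓜) ] x ∈ dom Y × (∀ˣ x Y ≗T ∃ˣ x X) × (𝓜 , Y ⊨ φ)

-- A team Y with x ∈ dom Y is determined by its projection ∃x Y together with
-- its fibres F s = {a | s[a/x] ∈ Y}: Y = (∃x Y)[F/x], and F never takes the
-- value ∅ on ∃x Y.  Hence the witnesses Y for ∃xφ at X correspond exactly to
-- the functions F : ∃xX → 𝒫(M) ∖ {∅}.  For ∀xφ split Y along ∀x Y:
-- Y = (∀x Y)[M/x] ∪ (∀x Y)ᶜ[F/x], where now F never takes the value M on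
-- (∀x Y)ᶜ; the split needs excluded middle.
module Submission where

open import Defs
open import Axiom.ExcludedMiddle using (ExcludedMiddle)
open import Data.Empty using (⊥-elim)
open import Data.List using (_∷_)
open import Data.List.Membership.Propositional using (_∈_; _∉_)
open import Data.List.Membership.Propositional.Properties using (∈-filter⁺; ∈-filter⁻)
open import Data.List.Relation.Binary.Subset.Propositional using (_⊆_)
open import Data.List.Relation.Unary.Any using (here; there)
open import Data.Nat using (_≟_)
open import Data.Product using (_×_; _,_; proj₁; proj₂; Σ-syntax)
open import Data.Sum using (inj₁; inj₂)
open import Function.Bundles using (_⇔_; mk⇔)
open import Level using (0ℓ; lift)
open import Relation.Binary.PropositionalEquality using (_≡_; refl; sym; trans; cong; subst)
open import Relation.Nullary using (¬_; yes; no; ¬?)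

∈-remove⁺ : ∀ x {v D} → v ∈ D → ¬ v ≡ x → v ∈ remove x D
∈-remove⁺ x = ∈-filter⁺ (λ w → ¬? (w ≟ x))

∈-remove⁻ : ∀ {x v} D → v ∈ remove x D → v ∈ D × ¬ v ≡ x
∈-remove⁻ {x} _ = ∈-filter⁻ (λ w → ¬? (w ≟ x))

x∉remove-x : ∀ x D → x ∉ remove x D
x∉remove-x x D x∈ = proj₂ (∈-remove⁻ D x∈) refl

⊆-∷-remove : ∀ x D → D ⊆ x ∷ remove x D
⊆-∷-remove x D {v} v∈ with v ≟ x
... | yes refl = here refl
... | no v≢x   = there (∈-remove⁺ x v∈ v≢x)

SameDom-sym : ∀ {D E} → SameDom D E → SameDom E D
SameDom-sym d v = proj₂ (d v) , proj₁ (d v)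

SameDom-trans : ∀ {D E G} → SameDom D E → SameDom E G → SameDom D G
SameDom-trans d e v = (λ i → proj₁ (e v) (proj₁ (d v) i)) , (λ i → proj₂ (d v) (proj₂ (e v) i))

SameDom-∷ : ∀ x {D E} → SameDom D E → SameDom (x ∷ D) (x ∷ E)
SameDom-∷ x d v = extend (proj₁ (d v)) , extend (proj₂ (d v))
  where
  extend : ∀ {A B} → (v ∈ A → v ∈ B) → v ∈ x ∷ A → v ∈ x ∷ B
  extend f (here v≡x) = here v≡x
  extend f (there i)  = there (f i)

SameDom-remove : ∀ x {D E} → SameDom D E → SameDom (remove x D) (remove x E)
SameDom-remove x {D} {E} d v = move D E (proj₁ (d v)) , move E D (proj₂ (d v))
  where
  move : ∀ A B → (v ∈ A → v ∈ B) → v ∈ remove x A → v ∈ remove x B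
  move A B f i = let (v∈A , v≢x) = ∈-remove⁻ A i in ∈-remove⁺ x (f v∈A) v≢x

SameDom-∷-remove : ∀ {x D} → x ∈ D → SameDom D (x ∷ remove x D)
SameDom-∷-remove {x} {D} x∈D v = ⊆-∷-remove x D , back
  where
  back : v ∈ x ∷ remove x D → v ∈ D
  back (here refl) = x∈D
  back (there i)   = proj₁ (∈-remove⁻ D i)

SameDom-remove-∷ : ∀ {x D} → x ∉ D → SameDom (remove x (x ∷ D)) D
SameDom-remove-∷ {x} {D} x∉D v = forth , λ i → ∈-remove⁺ x {D = x ∷ D} (there i) (λ { refl → x∉D i })
  where
  forth : v ∈ remove x (x ∷ D) → v ∈ D
  forth i with ∈-remove⁻ (x ∷ D) i
  ... | here v≡x , v≢x = ⊥-elim (v≢x v≡x)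
  ... | there v∈D , _  = v∈D

SameDom-insert : ∀ {x D E} → x ∈ D → SameDom (remove x D) E → SameDom D (x ∷ E)
SameDom-insert {x} x∈D d = SameDom-trans (SameDom-∷-remove x∈D) (SameDom-∷ x d)

module _ {M : Set} where

  update-self : (t : Asg M) (x v : Var) → (t [ t x / x ]) v ≡ t v
  update-self t x v with v ≟ x
  ... | yes v≡x = cong t (sym v≡x)
  ... | no _    = refl

  update-≡ : (s : Asg M) (a : M) (x : Var) → (s [ a / x ]) x ≡ a
  update-≡ s a x with x ≟ x
  ... | yes _   = refl
  ... | no x≢x  = ⊥-elim (x≢x refl)

  update-≢ : (s : Asg M) (a : M) {x v : Var} → ¬ v ≡ x → (s [ a / x ]) v ≡ s v
  update-≢ s a {x} {v} v≢x with v ≟ x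
  ... | yes v≡x = ⊥-elim (v≢x v≡x)
  ... | no _    = refl

  Agree-sym : ∀ {D} {s t : Asg M} → Agree D s t → Agree D t s
  Agree-sym ag v v∈ = sym (ag v v∈)

  Agree-⊆ : ∀ {D E} {s t : Asg M} → D ⊆ E → Agree E s t → Agree D s t
  Agree-⊆ D⊆E ag v v∈ = ag v (D⊆E v∈)

  Agree-SameDom : ∀ {D E} {s t : Asg M} → SameDom D E → Agree D s t → Agree E s t
  Agree-SameDom d = Agree-⊆ (λ {v} → proj₂ (d v))

  Agree-update-self : ∀ D (t : Asg M) x → Agree D t (t [ t x / x ])
  Agree-update-self D t x v _ = sym (update-self t x v)

  Agree-update : ∀ {D} {s t : Asg M} x a → Agree (remove x D) s t →
                 Agree D (s [ a / x ]) (t [ a / x ])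
  Agree-update x a ag v v∈ with v ≟ x
  ... | yes _   = refl
  ... | no v≢x  = ag v (∈-remove⁺ x v∈ v≢x)

  Agree-update⁻ : ∀ {x D} {s t : Asg M} {a b} → x ∉ D →
                  Agree (x ∷ D) (t [ b / x ]) (s [ a / x ]) → Agree D t s × b ≡ a
  Agree-update⁻ {x} {s = s} {t} {a} {b} x∉D ag =
    (λ v v∈ → let v≢x = λ { refl → x∉D v∈ } in
              trans (sym (update-≢ t b v≢x)) (trans (ag v (there v∈)) (update-≢ s a v≢x))) ,
    trans (sym (update-≡ t b x)) (trans (ag x (here refl)) (update-≡ s a x))

  resp-SameDom : ∀ (Y : Team M) {D} {s t : Asg M} → SameDom (dom Y) D → Agree D s t → mem Y s → mem Y t
  resp-SameDom Y d ag = resp Y (Agree-SameDom (SameDom-sym d) ag)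

  ≗T-trans : {X Y Z : Team M} → X ≗T Y → Y ≗T Z → X ≗T Z
  ≗T-trans (d , m) (e , n) =
    SameDom-trans d e , λ s → (λ i → proj₁ (n s) (proj₁ (m s) i)) , (λ i → proj₂ (m s) (proj₂ (n s) i))

  ∃ˣ-cong : ∀ x {X Y : Team M} → X ≗T Y → ∃ˣ x X ≗T ∃ˣ x Y
  ∃ˣ-cong x (d , m) =
    SameDom-remove x d , λ s → (λ (a , i) → a , proj₁ (m _) i) , (λ (a , i) → a , proj₂ (m _) i)

  fibre : Var → Team M → Asg M → M → Set
  fibre x Y s a = mem Y (s [ a / x ])

  fibre-wellDefined : ∀ x (Y : Team M) {Z : Team M} → SameDom (remove x (dom Y)) (dom Z) →
                      WellDefinedOn Z (fibre x Y)
  fibre-wellDefined x Y d ag a = resp Y (Agree-update x a (Agree-SameDom (SameDom-sym d) ag))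

  ≗T-fibres : ∀ {x} (Y : Team M) {Z : Team M} → x ∈ dom Y → ∃ˣ x Y ≗T Z →
              Y ≗T (Z [ fibre x Y / x ]ᵀ)
  ≗T-fibres {x} Y x∈ (d , m) = dY , λ t →
    (λ i → let i' = resp Y (Agree-update-self (dom Y) t x) i in
           t , proj₁ (m t) (t x , i') , t x , i' , Agree-update-self _ t x) ,
    (λ (s , _ , a , f , ag) → resp-SameDom Y dY (Agree-sym ag) f)
    where
    dY = SameDom-insert x∈ d

  ≗T-fibres-∀ˣ : ExcludedMiddle 0ℓ → ∀ {x} (Y : Team M) {Z : Team M} → x ∈ dom Y → ∀ˣ x Y ≗T Z →
                 Y ≗T ∪ᵀ (Z [M/ x ]) ((Z ᶜ) [ fibre x Y / x ]ᵀ) refl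
  ≗T-fibres-∀ˣ lem {x} Y {Z} x∈ (d , m) = dY , λ t → split t , join t
    where
    dY = SameDom-insert x∈ d

    split : ∀ t → mem Y t → mem (∪ᵀ (Z [M/ x ]) ((Z ᶜ) [ fibre x Y / x ]ᵀ) refl) t
    split t i with lem {mem Z t}
    ... | yes t∈Z = inj₁ (t , t∈Z , t x , Agree-update-self _ t x)
    ... | no t∉Z  = inj₂ (t , t∉Z , t x , resp Y (Agree-update-self (dom Y) t x) i ,
                          Agree-update-self _ t x)

    join : ∀ t → mem (∪ᵀ (Z [M/ x ]) ((Z ᶜ) [ fibre x Y / x ]ᵀ) refl) t → mem Y t
    join t (inj₁ (s , s∈Z , a , ag))   = resp-SameDom Y dY (Agree-sym ag) (proj₂ (m s) s∈Z a)
    join t (inj₂ (s , _ , a , f , ag)) = resp-SameDom Y dY (Agree-sym ag) f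

  ∃ˣ-[/]ᵀ : ∀ {x} (X : Team M) F → x ∉ dom X → (∀ s → mem X s → Σ[ a ∈ M ] F s a) →
            ∃ˣ x (X [ F / x ]ᵀ) ≗T X
  ∃ˣ-[/]ᵀ X F x∉ nonempty = SameDom-remove-∷ x∉ , λ t →
    (λ (_ , s , i , _ , _ , ag) → resp X (Agree-sym (proj₁ (Agree-update⁻ x∉ ag))) i) ,
    (λ i → let (a , f) = nonempty t i in a , t , i , a , f , λ _ _ → refl)

  ∀ˣ-∪ᵀ-[M/] : ExcludedMiddle 0ℓ → ∀ {x} (X : Team M) F → x ∉ dom X →
               WellDefinedOn (X ᶜ) F → (∀ s → mem (X ᶜ) s → ¬ (∀ a → F s a)) →
               ∀ˣ x (∪ᵀ (X [M/ x ]) ((X ᶜ) [ F / x ]ᵀ) refl) ≗T X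
  ∀ˣ-∪ᵀ-[M/] lem {x} X F x∉ wd notFull = SameDom-remove-∷ x∉ , λ t →
    recover t , λ i b → inj₁ (t , i , b , λ _ _ → refl)
    where
    recover : ∀ t → (∀ b → mem (∪ᵀ (X [M/ x ]) ((X ᶜ) [ F / x ]ᵀ) refl) (t [ b / x ])) → mem X t
    recover t all∪ with lem {mem X t}
    ... | yes t∈X = t∈X
    ... | no t∉X  = ⊥-elim (notFull t t∉X full)
      where
      full : ∀ b → F t b
      full b with all∪ b
      ... | inj₁ (s , s∈X , _ , ag) =
            ⊥-elim (t∉X (resp X (Agree-sym (proj₁ (Agree-update⁻ x∉ ag))) s∈X))
      ... | inj₂ (s , _ , a , f , ag) =
            let (t≈s , b≡a) = Agree-update⁻ x∉ ag in
            subst (F t) (sym b≡a) (wd (Agree-sym t≈s) a f)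

⊨-resp-≗T : {τ : Signature} (𝓜 : Structure τ) (φ : Formula τ) {X Y : Team (Carrier 𝓜)} →
            X ≗T Y → 𝓜 , X ⊨ φ → 𝓜 , Y ⊨ φ
⊨-resp-≗T 𝓜 (lit l) (_ , m) (lift sat) =
  lift λ s → (λ i → proj₁ (sat s) (proj₂ (m s) i)) , (λ i → proj₁ (m s) (proj₂ (sat s) i))
⊨-resp-≗T 𝓜 (φ ∧ⁱ ψ) (d , m) (Y , Z , dY , dZ , h , p , q) =
  Y , Z , SameDom-trans (SameDom-sym d) dY , SameDom-trans (SameDom-sym d) dZ ,
  (λ s → (λ i → proj₁ (h s) (proj₂ (m s) i)) , (λ i → proj₁ (m s) (proj₂ (h s) i))) , p , q
⊨-resp-≗T 𝓜 (φ ∨ⁱ ψ) (d , m) (Y , Z , dY , dZ , h , p , q) =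
  Y , Z , SameDom-trans (SameDom-sym d) dY , SameDom-trans (SameDom-sym d) dZ ,
  (λ s → (λ i → proj₁ (h s) (proj₂ (m s) i)) , (λ i → proj₁ (m s) (proj₂ (h s) i))) , p , q
⊨-resp-≗T 𝓜 (φ ∧ᵉ ψ) e (p , q)  = ⊨-resp-≗T 𝓜 φ e p , ⊨-resp-≗T 𝓜 ψ e q
⊨-resp-≗T 𝓜 (φ ∨ᵉ ψ) e (inj₁ p) = inj₁ (⊨-resp-≗T 𝓜 φ e p)
⊨-resp-≗T 𝓜 (φ ∨ᵉ ψ) e (inj₂ q) = inj₂ (⊨-resp-≗T 𝓜 ψ e q)
⊨-resp-≗T 𝓜 (ex x φ)  {X} {X'} e (Y , x∈ , eY , p) =
  Y , x∈ , ≗T-trans {X = ∃ˣ x Y} {∃ˣ x X} {∃ˣ x X'} eY (∃ˣ-cong x {X} {X'} e) , p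
⊨-resp-≗T 𝓜 (all x φ) {X} {X'} e (Y , x∈ , eY , p) =
  Y , x∈ , ≗T-trans {X = ∀ˣ x Y} {∃ˣ x X} {∃ˣ x X'} eY (∃ˣ-cong x {X} {X'} e) , p

module _ {τ : Signature} (𝓜 : Structure τ) (φ : Formula τ) (x : Var) (X : Team (Carrier 𝓜)) where

  private
    M = Carrier 𝓜
    E = ∃ˣ x X

  ⊨ex⇔fibres : (𝓜 , X ⊨ ex x φ) ⇔
               (Σ[ F ∈ (Asg M → M → Set) ] WellDefinedOn E F ×
                 (∀ s → mem E s → Σ[ a ∈ M ] F s a) × (𝓜 , E [ F / x ]ᵀ ⊨ φ))
  ⊨ex⇔fibres = mk⇔
    (λ (Y , x∈ , Y≗E , sat) →
      fibre x Y , fibre-wellDefined x Y {Z = E} (proj₁ Y≗E) , (λ s → proj₂ (proj₂ Y≗E s)) ,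
      ⊨-resp-≗T 𝓜 φ (≗T-fibres Y {E} x∈ Y≗E) sat)
    (λ (F , _ , nonempty , sat) →
      E [ F / x ]ᵀ , here refl , ∃ˣ-[/]ᵀ E F (x∉remove-x x (dom X)) nonempty , sat)

  ⊨all⇔fibres : ExcludedMiddle 0ℓ →
                (𝓜 , X ⊨ all x φ) ⇔
                (Σ[ F ∈ (Asg M → M → Set) ] WellDefinedOn (E ᶜ) F ×
                  (∀ s → mem (E ᶜ) s → ¬ (∀ a → F s a)) ×
                  (𝓜 , ∪ᵀ (E [M/ x ]) ((E ᶜ) [ F / x ]ᵀ) refl ⊨ φ))
  ⊨all⇔fibres lem = mk⇔
    (λ (Y , x∈ , Y≗E , sat) →
      fibre x Y , fibre-wellDefined x Y {Z = E ᶜ} (proj₁ Y≗E) ,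
      (λ s s∉E full → s∉E (proj₁ (proj₂ Y≗E s) full)) ,
      ⊨-resp-≗T 𝓜 φ (≗T-fibres-∀ˣ lem Y {E} x∈ Y≗E) sat)
    (λ (F , wd , notFull , sat) →
      _ , here refl , ∀ˣ-∪ᵀ-[M/] lem E F (x∉remove-x x (dom X)) wd notFull , sat)

mainTheorem5 : ExcludedMiddle 0ℓ →
    {τ : Signature} (𝓜 : Structure τ) (φ : Formula τ) (x : Var) (X : Team (Carrier 𝓜)) →
    (fv (ex x φ) ⊆ dom X →
      ((𝓜 , X ⊨ ex x φ) ⇔
        (Σ[ F ∈ (Asg (Carrier 𝓜) → Carrier 𝓜 → Set) ]
          WellDefinedOn (∃ˣ x X) F ×
          (∀ s → mem (∃ˣ x X) s → Σ[ a ∈ Carrier 𝓜 ] F s a) ×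
          (𝓜 , (∃ˣ x X) [ F / x ]ᵀ ⊨ φ))))
    ×
    (fv (all x φ) ⊆ dom X →
      ((𝓜 , X ⊨ all x φ) ⇔
        (Σ[ F ∈ (Asg (Carrier 𝓜) → Carrier 𝓜 → Set) ]
          WellDefinedOn ((∃ˣ x X) ᶜ) F ×
          (∀ s → mem ((∃ˣ x X) ᶜ) s → ¬ (∀ a → F s a)) ×
          (𝓜 , ∪ᵀ ((∃ˣ x X) [M/ x ]) (((∃ˣ x X) ᶜ) [ F / x ]ᵀ) refl ⊨ φ))))
mainTheorem5 lem 𝓜 φ x X = (λ _ → ⊨ex⇔fibres 𝓜 φ x X) , (λ _ → ⊨all⇔fibres 𝓜 φ x X lem)
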